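{- Let $a<b$ be two $n$-bit integers and let $\vec{e_{\sf a}}=(1,2,\dots,n)$. Then the probability that the inexact comparison of $a$ and $b$ under energy vector $\vec{e_{\sf a}}$ gives the wrong result satisfies $\Pr[I(a,b,\vec{e_{\sf a}})]<\frac{8}{b-a}$.
   Context: Bits of an $n$-bit integer are indexed $1,\dots,n$ with bit $n$ most significant. Under an energy vector $\vec{e}=(e_1,\dots,e_n)$, an inexact comparison of two integers reads each bit $j$ of each operand independently, flipping it with probability $2^{ -e_j}$, and compares the read values (bitwise from the most significant bit). $I(a,b,\vec{e})$ is the event that this comparison returns the wrong order of $a,b$. -}

module Defs where

open import Data.Bool using (Bool; false; if_then_else_; _xor_)
open import Data.Nat as ℕ using (ℕ; zero; suc; _^_; _<ᵇ_; _≡ᵇ_)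
open import Data.Nat.DivMod using (_/_; _%_)
open import Data.Nat.Properties using (m^n≢0)
open import Data.Fin using (Fin; toℕ)
open import Data.List using (map; upTo; foldr)
open import Data.Integer using (+_)
open import Data.Rational as ℚ using (ℚ; 1ℚ; 0ℚ)

-- bit j of a (1-indexed: j = 1 is least significant), j = suc i
bit : ℕ → ℕ → Bool
bit a zero    = false
bit a (suc i) = ((_/_ a (2 ^ i) {{m^n≢0 2 i}}) % 2) ≡ᵇ 1

flipProb : ℕ → ℚ
flipProb e = (+ 1 ℚ./ (2 ^ e)) {{m^n≢0 2 e}}

-- energy vector (e_1,…,e_n); index i : Fin n stands for bit j = toℕ i + 1
Energy : ℕ → Set
Energy n = Fin n → ℕ

eA : (n : ℕ) → Energy n
eA n i = suc (toℕ i)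

prodFin : (n : ℕ) → (Fin n → ℚ) → ℚ
prodFin zero    f = 1ℚ
prodFin (suc n) f = f Data.Fin.zero ℚ.* prodFin n (λ i → f (Data.Fin.suc i))

-- probability that the n-bit integer a is read as x under energy vector e
-- (each bit j flipped independently with probability 2^{-e_j})
readProb : (n : ℕ) → Energy n → ℕ → ℕ → ℚ
readProb n e a x = prodFin n λ i →
  let j = suc (toℕ i) in
  if bit a j xor bit x j then flipProb (e i) else 1ℚ ℚ.- flipProb (e i)

sumNBit : (n : ℕ) → (ℕ → ℚ) → ℚ
sumNBit n f = foldr ℚ._+_ 0ℚ (map f (upTo (2 ^ n)))

-- Pr[I(a,b,e)] for a < b: both operands are read independently and the
-- comparison of the read values fails to report a < b, i.e. read(a) ≥ read(b)
errProb : (n : ℕ) → Energy n → ℕ → ℕ → ℚ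
errProb n e a b =
  sumNBit n λ x → sumNBit n λ y →
    if y <ᵇ suc x then readProb n e a x ℚ.* readProb n e b y else 0ℚ

-- Choose K with 2·2^K ≤ b − a < 4·2^K. If the value x read for a agrees with a
-- in all bits above position K, then |x − a| < 2^K, and likewise for the value y
-- read for b; the gap b − a ≥ 2·2^K then forces x < y, i.e. a correct answer.
-- So an error requires one of the two reads to corrupt a bit above position K.
-- Under e_a each of these events has probability at most Σ_{j>K} 2^{-j} ≤ 2^{-K}
-- (a union bound, peeling off the lowest bit at a time), hence
-- Pr[I] ≤ 2·2^{-K} < 8/(b − a). (When b − a = 1 the bound 8 is trivial.)
module Submission where

open import Defs
open import Data.Nat using (ℕ; _<_; _^_; _∸_; NonZero)
open import Data.Integer using (+_)
open import Data.Rational as ℚ using (ℚ)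

open import Algebra.Bundles using (CommutativeMonoid)
open import Data.Bool using (Bool; true; false; not; if_then_else_; _xor_; T)
open import Data.Empty using (⊥-elim)
open import Data.Fin using (Fin; toℕ)
import Data.Fin as Fin
import Data.Integer as ℤ
open import Data.List using (foldr; applyUpTo; _∷_; [])
open import Data.List.Properties using (map-upTo)
import Data.Nat as ℕ
open import Data.Nat using (zero; suc; _≡ᵇ_; _<ᵇ_; z≤n; s≤s)
import Data.Nat.DivMod as ℕ
open import Data.Nat.DivMod using (_/_; _%_)
import Data.Nat.Properties as ℕ
open import Data.Nat.Tactic.RingSolver using (solve-∀) renaming (solve to solveℕ)
open import Data.Product using (∃-syntax; _×_; _,_)
open import Data.Rational using (0ℚ; 1ℚ; _+_; _*_; _-_; _≤_; toℚᵘ)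
import Data.Rational.Properties as ℚ
open import Data.Rational.Solver using (module +-*-Solver)
open +-*-Solver using (solve; _:+_; _:*_; _:-_; _:=_; con)
open import Data.Rational.Unnormalised as ℚᵘ using (mkℚᵘ; _≃_)
import Data.Rational.Unnormalised.Properties as ℚᵘ
open import Data.Sum using (_⊎_; inj₁; inj₂)
open import Data.Unit using (tt)
open import Data.Vec.Functional using (tail)
open import Function using (_∘_)
open import Relation.Binary.PropositionalEquality
open import Relation.Nullary.Decidable using (toWitness; dec-true; dec-false; does; yes; no)

open import Algebra.Properties.CommutativeSemigroup
  (CommutativeMonoid.commutativeSemigroup ℚ.+-0-commutativeMonoid) using (interchange)

sumBelow : ℕ → (ℕ → ℚ) → ℚ
sumBelow zero    f = 0ℚ
sumBelow (suc m) f = f 0 + sumBelow m (f ∘ suc)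

sumNBit≡sumBelow : ∀ n f → sumNBit n f ≡ sumBelow (2 ^ n) f
sumNBit≡sumBelow n f = trans (cong (foldr _+_ 0ℚ) (map-upTo f (2 ^ n))) (foldr-applyUpTo (2 ^ n) f)
  where
  foldr-applyUpTo : ∀ m (f : ℕ → ℚ) → foldr _+_ 0ℚ (applyUpTo f m) ≡ sumBelow m f
  foldr-applyUpTo zero    f = refl
  foldr-applyUpTo (suc m) f = cong (_+_ (f 0)) (foldr-applyUpTo m (f ∘ suc))

sumBelow-cong : ∀ m {f g : ℕ → ℚ} → (∀ x → f x ≡ g x) → sumBelow m f ≡ sumBelow m g
sumBelow-cong zero    f≡g = refl
sumBelow-cong (suc m) f≡g = cong₂ _+_ (f≡g 0) (sumBelow-cong m (f≡g ∘ suc))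

sumBelow-mono : ∀ m {f g : ℕ → ℚ} → (∀ x → f x ≤ g x) → sumBelow m f ≤ sumBelow m g
sumBelow-mono zero    f≤g = ℚ.≤-refl
sumBelow-mono (suc m) f≤g = ℚ.+-mono-≤ (f≤g 0) (sumBelow-mono m (f≤g ∘ suc))

sumBelow-distrib-+ : ∀ m (f g : ℕ → ℚ) → sumBelow m (λ x → f x + g x) ≡ sumBelow m f + sumBelow m g
sumBelow-distrib-+ zero    f g = refl
sumBelow-distrib-+ (suc m) f g =
  trans (cong (_+_ (f 0 + g 0)) (sumBelow-distrib-+ m (f ∘ suc) (g ∘ suc))) (interchange (f 0) (g 0) _ _)

*-distribʳ-sumBelow : ∀ m c (f : ℕ → ℚ) → sumBelow m f * c ≡ sumBelow m (λ x → f x * c)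
*-distribʳ-sumBelow zero    c f = ℚ.*-zeroˡ c
*-distribʳ-sumBelow (suc m) c f =
  trans (ℚ.*-distribʳ-+ c (f 0) _) (cong (_+_ (f 0 * c)) (*-distribʳ-sumBelow m c (f ∘ suc)))

p≤p+q : ∀ {p q} → 0ℚ ≤ q → p ≤ p + q
p≤p+q {p} q≥0 = ℚ.≤-trans (ℚ.≤-reflexive (sym (ℚ.+-identityʳ p))) (ℚ.+-monoʳ-≤ p q≥0)

p≤q+p : ∀ {p q} → 0ℚ ≤ q → p ≤ q + p
p≤q+p {p} {q} q≥0 = ℚ.≤-trans (p≤p+q q≥0) (ℚ.≤-reflexive (ℚ.+-comm p q))

*-nonNeg : ∀ {p q} → 0ℚ ≤ p → 0ℚ ≤ q → 0ℚ ≤ p * q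
*-nonNeg {p} {q} p≥0 q≥0 =
  ℚ.nonNegative⁻¹ (p * q) {{ℚ.nonNeg*nonNeg⇒nonNeg p {{ℚ.nonNegative p≥0}} q {{ℚ.nonNegative q≥0}}}}

xor≡false⇒≡ : ∀ {α β} → α xor β ≡ false → α ≡ β
xor≡false⇒≡ {false} {false} _ = refl
xor≡false⇒≡ {true}  {true}  _ = refl

χ : Bool → ℚ
χ true  = 1ℚ
χ false = 0ℚ

χ-nonNeg : ∀ b → 0ℚ ≤ χ b
χ-nonNeg true  = ℚ.nonNegative⁻¹ 1ℚ
χ-nonNeg false = ℚ.≤-refl

χ-≤-+ : ∀ b c d → (b ≡ true → c ≡ true ⊎ d ≡ true) → χ b ≤ χ c + χ d
χ-≤-+ false c d _ = ℚ.+-mono-≤ (χ-nonNeg c) (χ-nonNeg d)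
χ-≤-+ true c d cover with cover refl
... | inj₁ refl = p≤p+q (χ-nonNeg d)
... | inj₂ refl = p≤q+p (χ-nonNeg c)

consBit : Bool → ℕ → ℕ
consBit false x = x ℕ.* 2
consBit true  x = suc (x ℕ.* 2)

sumBelow-consBit : ∀ m (f : ℕ → ℚ) →
  sumBelow (2 ℕ.* m) f ≡ sumBelow m (λ x → f (consBit false x) + f (consBit true x))
sumBelow-consBit zero    f = refl
sumBelow-consBit (suc m) f rewrite ℕ.+-suc m (m ℕ.+ 0) =
  trans (cong (λ s → f 0 + (f 1 + s)) (sumBelow-consBit m (f ∘ suc ∘ suc)))
        (sym (ℚ.+-assoc (f 0) (f 1) _))

bit-1 : ∀ y → bit y 1 ≡ (y % 2 ≡ᵇ 1)
bit-1 y = cong (λ z → z % 2 ≡ᵇ 1) (ℕ.n/1≡n y)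

bit-suc-suc : ∀ y i → bit y (suc (suc i)) ≡ bit (y / 2) (suc i)
bit-suc-suc y i =
  cong (λ z → z % 2 ≡ᵇ 1) (sym (ℕ.m/n/o≡m/[n*o] y 2 (2 ^ i) {{_}} {{ℕ.m^n≢0 2 i}} {{ℕ.m^n≢0 2 (suc i)}}))

bit-1-consBit : ∀ β x → bit (consBit β x) 1 ≡ β
bit-1-consBit false x = trans (bit-1 (x ℕ.* 2)) (cong (_≡ᵇ 1) (ℕ.m*n%n≡0 x 2))
bit-1-consBit true  x = trans (bit-1 (suc (x ℕ.* 2))) (cong (_≡ᵇ 1) (ℕ.[m+kn]%n≡m%n 1 x 2))

consBit/2 : ∀ β x → consBit β x / 2 ≡ x
consBit/2 false x = ℕ.m*n/n≡m x 2
consBit/2 true  x = trans (ℕ.+-distrib-/ 1 (x ℕ.* 2) 1%2+x*2%2<2) (ℕ.m*n/n≡m x 2)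
  where
  1%2+x*2%2<2 : 1 % 2 ℕ.+ (x ℕ.* 2) % 2 < 2
  1%2+x*2%2<2 = subst (λ r → 1 ℕ.+ r < 2) (sym (ℕ.m*n%n≡0 x 2)) (s≤s (s≤s z≤n))

bit-1-∧-/2⇒≡ : ∀ x y → bit x 1 ≡ bit y 1 → x / 2 ≡ y / 2 → x ≡ y
bit-1-∧-/2⇒≡ x y bits≡ halves≡ = begin
  x                   ≡⟨ ℕ.m≡m%n+[m/n]*n x 2 ⟩
  x % 2 ℕ.+ x / 2 ℕ.* 2 ≡⟨ cong₂ (λ r q → r ℕ.+ q ℕ.* 2) parity≡ halves≡ ⟩
  y % 2 ℕ.+ y / 2 ℕ.* 2 ≡⟨ ℕ.m≡m%n+[m/n]*n y 2 ⟨
  y                   ∎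
  where
  open ≡-Reasoning
  parity≡ : x % 2 ≡ y % 2
  parity≡ = ≡ᵇ1-injective (x % 2) (y % 2) (ℕ.m%n<n x 2) (ℕ.m%n<n y 2)
              (trans (sym (bit-1 x)) (trans bits≡ (bit-1 y)))
    where
    ≡ᵇ1-injective : ∀ r s → r < 2 → s < 2 → (r ≡ᵇ 1) ≡ (s ≡ᵇ 1) → r ≡ s
    ≡ᵇ1-injective 0 0 _ _ _ = refl
    ≡ᵇ1-injective 1 1 _ _ _ = refl
    ≡ᵇ1-injective 0 1 _ _ ()
    ≡ᵇ1-injective 1 0 _ _ ()
    ≡ᵇ1-injective (suc (suc _)) _ (s≤s (s≤s ())) _ _
    ≡ᵇ1-injective _ (suc (suc _)) _ (s≤s (s≤s ())) _

toℚᵘ-/ : ∀ i d .{{_ : NonZero d}} → toℚᵘ (i ℚ./ d) ≃ mkℚᵘ i (ℕ.pred d)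
toℚᵘ-/ i (suc d) = ℚ.toℚᵘ-fromℚᵘ (mkℚᵘ i d)

toℚᵘ-flipProb : ∀ e → toℚᵘ (flipProb e) ≃ mkℚᵘ (+ 1) (ℕ.pred (2 ^ e))
toℚᵘ-flipProb e = toℚᵘ-/ (+ 1) (2 ^ e) {{ℕ.m^n≢0 2 e}}

toℚᵘ-flipProb-double : ∀ e → toℚᵘ (flipProb e + flipProb e) ≃ mkℚᵘ (+ 1) (ℕ.pred (2 ^ e)) ℚᵘ.+ mkℚᵘ (+ 1) (ℕ.pred (2 ^ e))
toℚᵘ-flipProb-double e =
  ℚᵘ.≃-trans (ℚ.toℚᵘ-homo-+ (flipProb e) (flipProb e)) (ℚᵘ.+-cong (toℚᵘ-flipProb e) (toℚᵘ-flipProb e))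

flipProb-halve : ∀ e → flipProb (suc e) + flipProb (suc e) ≡ flipProb e
flipProb-halve e = ℚ.toℚᵘ-injective
  (ℚᵘ.≃-trans (toℚᵘ-flipProb-double (suc e))
  (ℚᵘ.≃-trans (half-double (2 ^ e) {{ℕ.m^n≢0 2 e}}) (ℚᵘ.≃-sym (toℚᵘ-flipProb e))))
  where
  half-double : ∀ D .{{_ : NonZero D}} →
    mkℚᵘ (+ 1) (ℕ.pred (2 ℕ.* D)) ℚᵘ.+ mkℚᵘ (+ 1) (ℕ.pred (2 ℕ.* D)) ≃ mkℚᵘ (+ 1) (ℕ.pred D)
  half-double (suc k) = ℚᵘ.*≡* (cong +_ (solveℕ (k ∷ [])))

flipProb-nonNeg : ∀ e → 0ℚ ≤ flipProb e
flipProb-nonNeg e = ℚ.nonNegative⁻¹ _ {{ℚ.normalize-nonNeg 1 (2 ^ e) {{ℕ.m^n≢0 2 e}}}}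

flipProb-≤-1 : ∀ e → flipProb e ≤ 1ℚ
flipProb-≤-1 e = ℚ.toℚᵘ-cancel-≤ (ℚᵘ.≤-respˡ-≃ (ℚᵘ.≃-sym (toℚᵘ-flipProb e)) (≤-1 (2 ^ e) {{ℕ.m^n≢0 2 e}}))
  where
  ≤-1 : ∀ D .{{_ : NonZero D}} → mkℚᵘ (+ 1) (ℕ.pred D) ℚᵘ.≤ toℚᵘ 1ℚ
  ≤-1 (suc k) = ℚᵘ.*≤* (ℤ.+≤+ (s≤s z≤n))

flipProb-double-< : ∀ K d .{{_ : NonZero d}} → d < 2 ^ (2 ℕ.+ K) → flipProb K + flipProb K ℚ.< (+ 8) ℚ./ d
flipProb-double-< K d d<4·2^K = ℚ.toℚᵘ-cancel-<
  (ℚᵘ.<-respˡ-≃ (ℚᵘ.≃-sym (toℚᵘ-flipProb-double K))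
  (ℚᵘ.<-respʳ-≃ (ℚᵘ.≃-sym (toℚᵘ-/ (+ 8) d)) (unnormalised (2 ^ K) d {{ℕ.m^n≢0 2 K}} d<4·2^K)))
  where
  -- Unfolds to 2D·d < 8·D·D, which is d < 4D multiplied by 2D.
  unnormalised : ∀ D d .{{_ : NonZero D}} .{{_ : NonZero d}} → d < 2 ℕ.* (2 ℕ.* D) →
    mkℚᵘ (+ 1) (ℕ.pred D) ℚᵘ.+ mkℚᵘ (+ 1) (ℕ.pred D) ℚᵘ.< mkℚᵘ (+ 8) (ℕ.pred d)
  unnormalised (suc k) (suc j) d<4D =
    ℚᵘ.*<* (ℤ.+<+ (subst₂ _<_ 2D·d≡ 2D·4D≡ (ℕ.*-monoʳ-< (2 ℕ.* suc k) d<4D)))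
    where
    2D·d≡ : (2 ℕ.* suc k) ℕ.* suc j ≡ suc (j ℕ.+ (k ℕ.+ 0 ℕ.* suc k ℕ.+ suc (k ℕ.+ 0 ℕ.* suc k)) ℕ.* suc j)
    2D·d≡ = solveℕ (j ∷ k ∷ [])
    2D·4D≡ : (2 ℕ.* suc k) ℕ.* (2 ℕ.* (2 ℕ.* suc k)) ≡ suc (k ℕ.+ k ℕ.* suc k ℕ.+ 7 ℕ.* suc (k ℕ.+ k ℕ.* suc k))
    2D·4D≡ = solveℕ (k ∷ [])

bitFactor : ℕ → Bool → ℚ
bitFactor e flipped = if flipped then flipProb e else 1ℚ - flipProb e

bitFactor-nonNeg : ∀ e β → 0ℚ ≤ bitFactor e β
bitFactor-nonNeg e true  = flipProb-nonNeg e
bitFactor-nonNeg e false = begin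
  0ℚ               ≡⟨ ℚ.+-inverseʳ 1ℚ ⟨
  1ℚ - 1ℚ          ≤⟨ ℚ.+-monoʳ-≤ 1ℚ (ℚ.neg-antimono-≤ (flipProb-≤-1 e)) ⟩
  1ℚ - flipProb e  ∎
  where open ℚ.≤-Reasoning

prodFin-nonNeg : ∀ n (f : Fin n → ℚ) → (∀ i → 0ℚ ≤ f i) → 0ℚ ≤ prodFin n f
prodFin-nonNeg zero    f f≥0 = ℚ.nonNegative⁻¹ 1ℚ
prodFin-nonNeg (suc n) f f≥0 = *-nonNeg (f≥0 Fin.zero) (prodFin-nonNeg n (f ∘ Fin.suc) (f≥0 ∘ Fin.suc))

readProb-nonNeg : ∀ n e a x → 0ℚ ≤ readProb n e a x
readProb-nonNeg n e a x =
  prodFin-nonNeg n _ (λ i → bitFactor-nonNeg (e i) (bit a (suc (toℕ i)) xor bit x (suc (toℕ i))))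

readProb-suc : ∀ n e a y →
  readProb (suc n) e a y ≡ bitFactor (e Fin.zero) (bit a 1 xor bit y 1) * readProb n (tail e) (a / 2) (y / 2)
readProb-suc n e a y = cong (bitFactor (e Fin.zero) (bit a 1 xor bit y 1) *_) (prodFin-cong n λ i →
  cong₂ (λ α β → bitFactor (e (Fin.suc i)) (α xor β)) (bit-suc-suc a (toℕ i)) (bit-suc-suc y (toℕ i)))
  where
  prodFin-cong : ∀ n {f g : Fin n → ℚ} → (∀ i → f i ≡ g i) → prodFin n f ≡ prodFin n g
  prodFin-cong zero    f≡g = refl
  prodFin-cong (suc n) f≡g = cong₂ _*_ (f≡g Fin.zero) (prodFin-cong n (f≡g ∘ Fin.suc))

expect : (n : ℕ) → Energy n → ℕ → (ℕ → ℚ) → ℚ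
expect n e a w = sumBelow (2 ^ n) λ x → w x * readProb n e a x

expect-cong : ∀ n e a {v w : ℕ → ℚ} → (∀ x → v x ≡ w x) → expect n e a v ≡ expect n e a w
expect-cong n e a v≡w = sumBelow-cong (2 ^ n) (λ x → cong (_* _) (v≡w x))

expect-mono : ∀ n e a {v w : ℕ → ℚ} → (∀ x → v x ≤ w x) → expect n e a v ≤ expect n e a w
expect-mono n e a v≤w = sumBelow-mono (2 ^ n) λ x →
  ℚ.*-monoʳ-≤-nonNeg (readProb n e a x) {{ℚ.nonNegative (readProb-nonNeg n e a x)}} (v≤w x)

expect-distrib-+ : ∀ n e a (v w : ℕ → ℚ) → expect n e a (λ x → v x + w x) ≡ expect n e a v + expect n e a w
expect-distrib-+ n e a v w =
  trans (sumBelow-cong (2 ^ n) (λ x → ℚ.*-distribʳ-+ _ (v x) (w x))) (sumBelow-distrib-+ (2 ^ n) _ _)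

lowBitProb : ∀ {n} → Energy (suc n) → ℕ → Bool → ℚ
lowBitProb e a β = bitFactor (e Fin.zero) (bit a 1 xor β)

lowBitProb-sum : ∀ {n} (e : Energy (suc n)) a → lowBitProb e a false + lowBitProb e a true ≡ 1ℚ
lowBitProb-sum e a with bit a 1
... | true  = solve 1 (λ f → f :+ (con 1ℚ :- f) := con 1ℚ) refl (flipProb (e Fin.zero))
... | false = solve 1 (λ f → (con 1ℚ :- f) :+ f := con 1ℚ) refl (flipProb (e Fin.zero))

lowBitProb-flip : ∀ {n} (e : Energy (suc n)) a →
  χ (bit a 1 xor false) * lowBitProb e a false + χ (bit a 1 xor true) * lowBitProb e a true ≡ flipProb (e Fin.zero)
lowBitProb-flip e a with bit a 1
... | true  = solve 1 (λ f → con 1ℚ :* f :+ con 0ℚ :* (con 1ℚ :- f) := f) refl (flipProb (e Fin.zero))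
... | false = solve 1 (λ f → con 0ℚ :* (con 1ℚ :- f) :+ con 1ℚ :* f := f) refl (flipProb (e Fin.zero))

-- The lowest read bit is flipped independently of the others.
expect-lowBit : ∀ n e a (w : Bool → ℕ → ℚ) →
  expect (suc n) e a (λ y → w (bit y 1) (y / 2)) ≡
  expect n (tail e) (a / 2) (λ x → w false x * lowBitProb e a false + w true x * lowBitProb e a true)
expect-lowBit n e a w =
  trans (sumBelow-consBit (2 ^ n) _) (sumBelow-cong (2 ^ n) λ x →
    trans (cong₂ _+_ (term false x) (term true x)) (factor (w false x) (F false) (w true x) (F true) (R x)))
  where
  F = lowBitProb e a
  R = readProb n (tail e) (a / 2)
  term : ∀ β x → w (bit (consBit β x) 1) (consBit β x / 2) * readProb (suc n) e a (consBit β x) ≡ w β x * (F β * R x)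
  term β x = cong₂ _*_
    (cong₂ w (bit-1-consBit β x) (consBit/2 β x))
    (trans (readProb-suc n e a (consBit β x)) (cong₂ (λ γ z → F γ * R z) (bit-1-consBit β x) (consBit/2 β x)))
  factor : ∀ w₀ f₀ w₁ f₁ r → w₀ * (f₀ * r) + w₁ * (f₁ * r) ≡ (w₀ * f₀ + w₁ * f₁) * r
  factor = solve 5 (λ w₀ f₀ w₁ f₁ r → w₀ :* (f₀ :* r) :+ w₁ :* (f₁ :* r) := (w₀ :* f₀ :+ w₁ :* f₁) :* r) refl

c·lowBitProb-sum : ∀ {n} (e : Energy (suc n)) a c → c * lowBitProb e a false + c * lowBitProb e a true ≡ c
c·lowBitProb-sum e a c =
  trans (sym (ℚ.*-distribˡ-+ c _ _)) (trans (cong (c *_) (lowBitProb-sum e a)) (ℚ.*-identityʳ c))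

expect-const : ∀ n e a c → expect n e a (λ _ → c) ≡ c
expect-const zero    e a c = trans (ℚ.+-identityʳ (c * 1ℚ)) (ℚ.*-identityʳ c)
expect-const (suc n) e a c = begin
  expect (suc n) e a (λ _ → c)
    ≡⟨ expect-lowBit n e a (λ _ _ → c) ⟩
  expect n (tail e) (a / 2) (λ _ → c * lowBitProb e a false + c * lowBitProb e a true)
    ≡⟨ expect-cong n (tail e) (a / 2) (λ _ → c·lowBitProb-sum e a c) ⟩
  expect n (tail e) (a / 2) (λ _ → c)
    ≡⟨ expect-const n (tail e) (a / 2) c ⟩
  c ∎
  where open ≡-Reasoning

expect-/2 : ∀ n e a (w : ℕ → ℚ) → expect (suc n) e a (w ∘ (_/ 2)) ≡ expect n (tail e) (a / 2) w
expect-/2 n e a w =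
  trans (expect-lowBit n e a (λ _ → w)) (expect-cong n (tail e) (a / 2) (c·lowBitProb-sum e a ∘ w))

expect-lowBitFlip : ∀ n e a → expect (suc n) e a (λ y → χ (bit a 1 xor bit y 1)) ≡ flipProb (e Fin.zero)
expect-lowBitFlip n e a =
  trans (expect-lowBit n e a (λ β _ → χ (bit a 1 xor β)))
  (trans (expect-cong n (tail e) (a / 2) (λ _ → lowBitProb-flip e a))
         (expect-const n (tail e) (a / 2) (flipProb (e Fin.zero))))

expect-const-+ : ∀ n e a c (w : ℕ → ℚ) → expect n e a (λ x → c + w x) ≡ c + expect n e a w
expect-const-+ n e a c w = trans (expect-distrib-+ n e a (λ _ → c) w) (cong (_+ expect n e a w) (expect-const n e a c))

expect-+-const : ∀ n e a (w : ℕ → ℚ) c → expect n e a (λ x → w x + c) ≡ expect n e a w + c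
expect-+-const n e a w c = trans (expect-distrib-+ n e a w (λ _ → c)) (cong (_+_ (expect n e a w)) (expect-const n e a c))

prob : (n : ℕ) → Energy n → ℕ → (ℕ → Bool) → ℚ
prob n e a P = expect n e a (χ ∘ P)

-- differAbove K x a ⇔ ⌊x / 2^K⌋ ≢ ⌊a / 2^K⌋, i.e. x and a differ in some bit j > K.
differAbove : ℕ → ℕ → ℕ → Bool
differAbove zero    x a = not (does (x ℕ.≟ a))
differAbove (suc K) x a = differAbove K (x / 2) (a / 2)

differAbove-refl : ∀ K x → differAbove K x x ≡ false
differAbove-refl zero    x = cong not (dec-true (x ℕ.≟ x) refl)
differAbove-refl (suc K) x = differAbove-refl K (x / 2)

differAbove-zero-≢ : ∀ {x a} → x ≢ a → differAbove 0 x a ≡ true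
differAbove-zero-≢ {x} {a} x≢a = cong not (dec-false (x ℕ.≟ a) x≢a)

differAbove-sym : ∀ K x a → differAbove K x a ≡ differAbove K a x
differAbove-sym zero x a with x ℕ.≟ a
... | yes refl = refl
... | no x≢a   = trans (differAbove-zero-≢ x≢a) (sym (differAbove-zero-≢ (x≢a ∘ sym)))
differAbove-sym (suc K) x a = differAbove-sym K (x / 2) (a / 2)

¬differAbove⇒< : ∀ K x a → differAbove K x a ≡ false → x < a ℕ.+ 2 ^ K
¬differAbove⇒< zero x a same with x ℕ.≟ a
... | yes refl = ℕ.m<m+n x (s≤s z≤n)
... | no x≢a   with () ← trans (sym (differAbove-zero-≢ x≢a)) same
¬differAbove⇒< (suc K) x a same = begin-strict
  x                             ≡⟨ ℕ.m≡m%n+[m/n]*n x 2 ⟩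
  x % 2 ℕ.+ (x / 2) ℕ.* 2        <⟨ ℕ.+-monoˡ-< ((x / 2) ℕ.* 2) (ℕ.m%n<n x 2) ⟩
  suc (x / 2) ℕ.* 2             ≤⟨ ℕ.*-monoˡ-≤ 2 (¬differAbove⇒< K (x / 2) (a / 2) same) ⟩
  (a / 2 ℕ.+ 2 ^ K) ℕ.* 2        ≡⟨ ℕ.*-distribʳ-+ 2 (a / 2) (2 ^ K) ⟩
  (a / 2) ℕ.* 2 ℕ.+ 2 ^ K ℕ.* 2   ≤⟨ ℕ.+-monoˡ-≤ (2 ^ K ℕ.* 2) (ℕ.m/n*n≤m a 2) ⟩
  a ℕ.+ 2 ^ K ℕ.* 2              ≡⟨ cong (a ℕ.+_) (ℕ.*-comm (2 ^ K) 2) ⟩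
  a ℕ.+ 2 ^ suc K               ∎
  where open ℕ.≤-Reasoning

differAbove-zero-cover : ∀ y a → differAbove 0 y a ≡ true →
  bit a 1 xor bit y 1 ≡ true ⊎ differAbove 0 (y / 2) (a / 2) ≡ true
differAbove-zero-cover y a differ with bit a 1 xor bit y 1 in bits | y / 2 ℕ.≟ a / 2
... | true  | _            = inj₁ refl
... | false | no halves≢   = inj₂ (differAbove-zero-≢ halves≢)
... | false | yes halves≡ with () ← trans (sym differ)
  (subst (λ z → differAbove 0 y z ≡ false) (bit-1-∧-/2⇒≡ y a (sym (xor≡false⇒≡ bits)) halves≡) (differAbove-refl 0 y))

-- e_a is the case s = 0; the shift is needed because the tail of e_a is not e_a.
ShiftedEA : ∀ {n} → ℕ → Energy n → Set
ShiftedEA s e = ∀ i → e i ≡ s ℕ.+ suc (toℕ i)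

ShiftedEA-tail : ∀ {n s} {e : Energy (suc n)} → ShiftedEA s e → ShiftedEA (suc s) (tail e)
ShiftedEA-tail {s = s} e≡ i = trans (e≡ (Fin.suc i)) (ℕ.+-suc s (suc (toℕ i)))

/2<2^ : ∀ n {a} → a < 2 ^ suc n → a / 2 < 2 ^ n
/2<2^ n {a} a<2ⁿ⁺¹ = ℕ.m<n*o⇒m/o<n (subst (a <_) (ℕ.*-comm 2 (2 ^ n)) a<2ⁿ⁺¹)

prob-differAbove : ∀ n s (e : Energy n) K a → ShiftedEA s e → a < 2 ^ n →
  prob n e a (λ x → differAbove K x a) ≤ flipProb (s ℕ.+ K)
prob-differAbove zero s e K a _ a<1 rewrite ℕ.n<1⇒n≡0 a<1 | differAbove-refl K 0 = flipProb-nonNeg (s ℕ.+ K)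
prob-differAbove (suc n) s e (suc K) a e≡ a<2ⁿ⁺¹ = begin
  prob (suc n) e a (λ x → differAbove (suc K) x a)
    ≡⟨ expect-/2 n e a (χ ∘ λ x → differAbove K x (a / 2)) ⟩
  prob n (tail e) (a / 2) (λ x → differAbove K x (a / 2))
    ≤⟨ prob-differAbove n (suc s) (tail e) K (a / 2) (ShiftedEA-tail e≡) (/2<2^ n a<2ⁿ⁺¹) ⟩
  flipProb (suc s ℕ.+ K)
    ≡⟨ cong flipProb (ℕ.+-suc s K) ⟨
  flipProb (s ℕ.+ suc K) ∎
  where open ℚ.≤-Reasoning
prob-differAbove (suc n) s e zero a e≡ a<2ⁿ⁺¹ = begin
  prob (suc n) e a (λ y → differAbove 0 y a)
    ≤⟨ expect-mono (suc n) e a (λ y → χ-≤-+ _ _ _ (differAbove-zero-cover y a)) ⟩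
  expect (suc n) e a (λ y → χ (bit a 1 xor bit y 1) + χ (differAbove 0 (y / 2) (a / 2)))
    ≡⟨ expect-distrib-+ (suc n) e a (λ y → χ (bit a 1 xor bit y 1)) (χ ∘ λ y → differAbove 0 (y / 2) (a / 2)) ⟩
  expect (suc n) e a (λ y → χ (bit a 1 xor bit y 1)) + prob (suc n) e a (λ y → differAbove 0 (y / 2) (a / 2))
    ≡⟨ cong₂ _+_ (expect-lowBitFlip n e a) (expect-/2 n e a (χ ∘ λ x → differAbove 0 x (a / 2))) ⟩
  flipProb (e Fin.zero) + prob n (tail e) (a / 2) (λ x → differAbove 0 x (a / 2))
    ≤⟨ ℚ.+-monoʳ-≤ (flipProb (e Fin.zero))
         (prob-differAbove n (suc s) (tail e) 0 (a / 2) (ShiftedEA-tail e≡) (/2<2^ n a<2ⁿ⁺¹)) ⟩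
  flipProb (e Fin.zero) + flipProb (suc s ℕ.+ 0)
    ≡⟨ cong₂ (λ u v → flipProb u + flipProb v) (trans (e≡ Fin.zero) (ℕ.+-comm s 1)) (ℕ.+-identityʳ (suc s)) ⟩
  flipProb (suc s) + flipProb (suc s)
    ≡⟨ flipProb-halve s ⟩
  flipProb s
    ≡⟨ cong flipProb (ℕ.+-identityʳ s) ⟨
  flipProb (s ℕ.+ 0) ∎
  where open ℚ.≤-Reasoning

if-then-0≡χ* : ∀ c r → (if c then r else 0ℚ) ≡ χ c * r
if-then-0≡χ* true  r = sym (ℚ.*-identityˡ r)
if-then-0≡χ* false r = sym (ℚ.*-zeroˡ r)

errProb-≤-prob+prob : ∀ n e a b (P Q : ℕ → Bool) → (∀ x y → y ℕ.≤ x → P x ≡ true ⊎ Q y ≡ true) →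
  errProb n e a b ≤ prob n e a P + prob n e b Q
errProb-≤-prob+prob n e a b P Q cover = begin
  errProb n e a b
    ≡⟨ trans (sumNBit≡sumBelow n _) (sumBelow-cong M (λ x → sumNBit≡sumBelow n _)) ⟩
  sumBelow M (λ x → sumBelow M (λ y → if y <ᵇ suc x then A x * B y else 0ℚ))
    ≤⟨ sumBelow-mono M (λ x → sumBelow-mono M (λ y → wrong≤ x y)) ⟩
  sumBelow M (λ x → sumBelow M (λ y → (χ (P x) + χ (Q y)) * B y * A x))
    ≡⟨ sumBelow-cong M (λ x → *-distribʳ-sumBelow M (A x) _) ⟨
  expect n e a (λ x → expect n e b (λ y → χ (P x) + χ (Q y)))
    ≡⟨ expect-cong n e a (λ x → expect-const-+ n e b (χ (P x)) (χ ∘ Q)) ⟩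
  expect n e a (λ x → χ (P x) + prob n e b Q)
    ≡⟨ expect-+-const n e a (χ ∘ P) (prob n e b Q) ⟩
  prob n e a P + prob n e b Q ∎
  where
  open ℚ.≤-Reasoning
  M = 2 ^ n
  A = readProb n e a
  B = readProb n e b
  wrong≤ : ∀ x y → (if y <ᵇ suc x then A x * B y else 0ℚ) ≤ (χ (P x) + χ (Q y)) * B y * A x
  wrong≤ x y = begin
    (if y <ᵇ suc x then A x * B y else 0ℚ)
      ≡⟨ if-then-0≡χ* (y <ᵇ suc x) (A x * B y) ⟩
    χ (y <ᵇ suc x) * (A x * B y)
      ≤⟨ ℚ.*-monoʳ-≤-nonNeg (A x * B y) {{ℚ.nonNegative (*-nonNeg (readProb-nonNeg n e a x) (readProb-nonNeg n e b y))}}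
           (χ-≤-+ _ _ _ (λ y<x+1 → cover x y (ℕ.s≤s⁻¹ (ℕ.<ᵇ⇒< y (suc x) (subst T (sym y<x+1) tt))))) ⟩
    (χ (P x) + χ (Q y)) * (A x * B y)
      ≡⟨ solve 3 (λ c α β → c :* (α :* β) := c :* β :* α) refl (χ (P x) + χ (Q y)) (A x) (B y) ⟩
    (χ (P x) + χ (Q y)) * B y * A x ∎

errProb-≤-1 : ∀ n e a b → errProb n e a b ≤ 1ℚ
errProb-≤-1 n e a b = ℚ.≤-trans
  (errProb-≤-prob+prob n e a b (λ _ → true) (λ _ → false) (λ _ _ _ → inj₁ refl))
  (ℚ.≤-reflexive (cong₂ _+_ (expect-const n e a 1ℚ) (expect-const n e b 0ℚ)))

readsOrdered : ∀ K x y a b → 2 ℕ.* 2 ^ K ℕ.+ a ℕ.≤ b →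
  differAbove K x a ≡ false → differAbove K y b ≡ false → x < y
readsOrdered K x y a b gap x≈a y≈b = ℕ.+-cancelʳ-< (2 ^ K) x y (begin-strict
  x ℕ.+ 2 ^ K             <⟨ ℕ.+-monoˡ-< (2 ^ K) (¬differAbove⇒< K x a x≈a) ⟩
  a ℕ.+ 2 ^ K ℕ.+ 2 ^ K    ≡⟨ rearrange a (2 ^ K) ⟩
  2 ℕ.* 2 ^ K ℕ.+ a        ≤⟨ gap ⟩
  b                       <⟨ ¬differAbove⇒< K b y (trans (differAbove-sym K b y) y≈b) ⟩
  y ℕ.+ 2 ^ K             ∎)
  where
  open ℕ.≤-Reasoning
  rearrange : ∀ a P → a ℕ.+ P ℕ.+ P ≡ 2 ℕ.* P ℕ.+ a
  rearrange = solve-∀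

errProb-eA-≤ : ∀ n a b K → a < 2 ^ n → b < 2 ^ n → 2 ℕ.* 2 ^ K ℕ.+ a ℕ.≤ b →
  errProb n (eA n) a b ≤ flipProb K + flipProb K
errProb-eA-≤ n a b K a<2ⁿ b<2ⁿ gap = ℚ.≤-trans
  (errProb-≤-prob+prob n (eA n) a b (λ x → differAbove K x a) (λ y → differAbove K y b) cover)
  (ℚ.+-mono-≤ (prob-differAbove n 0 (eA n) K a (λ _ → refl) a<2ⁿ) (prob-differAbove n 0 (eA n) K b (λ _ → refl) b<2ⁿ))
  where
  cover : ∀ x y → y ℕ.≤ x → differAbove K x a ≡ true ⊎ differAbove K y b ≡ true
  cover x y y≤x with differAbove K x a in x≈a | differAbove K y b in y≈b
  ... | true  | _     = inj₁ refl
  ... | false | true  = inj₂ refl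
  ... | false | false = ⊥-elim (ℕ.<⇒≱ (readsOrdered K x y a b gap x≈a y≈b) y≤x)

binaryMagnitude : ∀ m d → 0 < d → d < 2 ^ m → ∃[ L ] 2 ^ L ℕ.≤ d × d < 2 ^ suc L
binaryMagnitude zero    d 0<d d<1 = ⊥-elim (ℕ.<-irrefl refl (ℕ.≤-<-trans 0<d d<1))
binaryMagnitude (suc m) d 0<d d<2ᵐ⁺¹ with d ℕ.<? 2 ^ m
... | yes d<2ᵐ = binaryMagnitude m d 0<d d<2ᵐ
... | no d≮2ᵐ  = m , ℕ.≮⇒≥ d≮2ᵐ , d<2ᵐ⁺¹

1<8/d : ∀ d .{{_ : NonZero d}} → d < 2 → 1ℚ ℚ.< (+ 8) ℚ./ d
1<8/d 1 _ = toWitness {a? = 1ℚ ℚ.<? (+ 8) ℚ./ 1} tt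
1<8/d (suc (suc _)) (s≤s (s≤s ()))

lemma3 : (n a b : ℕ) → a < 2 ^ n → b < 2 ^ n → a < b → .{{_ : NonZero (b ∸ a)}} →
    errProb n (eA n) a b ℚ.< (+ 8) ℚ./ (b ∸ a)
lemma3 n a b a<2ⁿ b<2ⁿ a<b
  with binaryMagnitude n (b ∸ a) (ℕ.>-nonZero⁻¹ (b ∸ a)) (ℕ.≤-<-trans (ℕ.m∸n≤m b a) b<2ⁿ)
... | zero  , _ , d<2 = ℚ.≤-<-trans (errProb-≤-1 n (eA n) a b) (1<8/d (b ∸ a) d<2)
... | suc K , 2·2ᴷ≤d , d<4·2ᴷ =
  ℚ.≤-<-trans (errProb-eA-≤ n a b K a<2ⁿ b<2ⁿ gap) (flipProb-double-< K (b ∸ a) d<4·2ᴷ)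
  where
  gap : 2 ℕ.* 2 ^ K ℕ.+ a ℕ.≤ b
  gap = subst (2 ℕ.* 2 ^ K ℕ.+ a ℕ.≤_) (ℕ.m∸n+n≡m (ℕ.<⇒≤ a<b)) (ℕ.+-monoˡ-≤ a 2·2ᴷ≤d)
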